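{- Let $K \geq 2$, $p \geq 1$ and $0 \le j \le n$ be integers, and let $\sigma = \sigma'(j+1)(j+2)\ldots n$ where $\sigma'$ is a permutation of $[1..j]$. If $\sigma$ can be obtained from $12\ldots n$ after $p$ duplication-loss steps of width at most $K$, then $\sigma$ can be obtained from $12\ldots n$ after $p$ duplication-loss steps of width at most $K$ such that, at each step, the duplicated window contains only entries from $\{1,\ldots,j\}$ (i.e. does not intersect $\{j+1,\ldots,n\}$).
   Context: A duplication-loss step of width $k$ applied to a permutation $\pi$ chooses a contiguous fragment (duplicated window) of $k$ consecutive positions and a subset $S$ of its entries, and replaces the fragment by the entries of $S$ in their original relative order followed by the remaining entries of the fragment in their original relative order. -}

module Defs where

open import Data.Nat using (ℕ; zero; suc; _≤_; _+_)
open import Data.Bool using (Bool; true; false; not)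
open import Data.List using (List; []; _∷_; _++_; length; upTo; map; filter)
open import Data.List.Relation.Unary.All using (All)
open import Data.List.Relation.Binary.Permutation.Propositional using (_↭_)
open import Data.Product using (_×_; Σ; ∃; ∃-syntax)
open import Relation.Binary.PropositionalEquality using (_≡_)
import Data.Bool
import Relation.Nullary
import Data.Unit

idPerm : ℕ → List ℕ
idPerm n = map suc (upTo n)

select : Bool → List ℕ → List Bool → List ℕ
select b []       _        = []
select b (x ∷ xs) []       = []
select b (x ∷ xs) (c ∷ cs) with c Data.Bool.≟ b
... | Relation.Nullary.yes _ = x ∷ select b xs cs
... | Relation.Nullary.no  _ = select b xs cs

-- One duplication-loss step of width at most K, where the duplicated
-- window W must additionally satisfy the predicate Ok.
-- π = A ++ W ++ B, the subset S of W is given by a Bool mask (true = in S),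
-- and the result is A ++ (S-entries of W) ++ (other entries of W) ++ B.
record DLStep (K : ℕ) (Ok : List ℕ → Set) (π τ : List ℕ) : Set where
  constructor dlstep
  field
    A W B   : List ℕ
    mask    : List Bool
    split   : π ≡ A ++ W ++ B
    maskLen : length mask ≡ length W
    width   : length W ≤ K
    okW     : Ok W
    result  : τ ≡ A ++ select true W mask ++ select false W mask ++ B

data DLSteps (K : ℕ) (Ok : List ℕ → Set) : ℕ → List ℕ → List ℕ → Set where
  done : ∀ {π} → DLSteps K Ok zero π π
  step : ∀ {p π ρ τ} → DLStep K Ok π ρ → DLSteps K Ok p ρ τ → DLSteps K Ok (suc p) π τ

AnyWindow : List ℕ → Set
AnyWindow _ = Data.Unit.⊤

WindowIn : ℕ → List ℕ → Set
WindowIn j W = All (λ x → x ≤ j) W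

module Submission where

-- Deleting the entries larger than j from every permutation of a scenario
-- turns each duplication-loss step into one whose window is the filtered old
-- window: the width can only drop, and the mask restricted to the surviving
-- positions splits them exactly as before.  Appending the fixed tail
-- (j+1)(j+2)…n afterwards does not affect the steps, and since the endpoints
-- 12…n and σ'(j+1)…n consist of a prefix over {1..j} followed by that tail,
-- the projected scenario has the same endpoints.

open import Defs
open import Data.Nat using (ℕ; zero; suc; pred; _≤_; _<_; _+_; _∸_; z<s; _≤?_)
open import Data.Nat.Properties using (m+[n∸m]≡n; +-suc; m<m+n; ≤-trans; <⇒≱)
open import Data.Bool using (Bool; true; false)
open import Data.List using (List; []; _∷_; _++_; map; upTo; applyUpTo; filter; length)
open import Data.List.Properties
  using (++-assoc; ++-identityʳ; map-++; map-∘; map-cong; map-upTo; filter-++; filter-all; filter-none; length-filter)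
open import Data.List.Relation.Unary.All using (All)
import Data.List.Relation.Unary.All as All
open import Data.List.Relation.Unary.All.Properties using (applyUpTo⁺₁; applyUpTo⁺₂; all-filter; map⁺)
open import Data.List.Relation.Binary.Permutation.Propositional using (_↭_; ↭-sym)
open import Data.List.Relation.Binary.Permutation.Propositional.Properties using (All-resp-↭)
open import Relation.Binary.PropositionalEquality
open import Relation.Nullary using (does)
open import Relation.Unary using (Pred; Decidable; ∁)
open import Level using (0ℓ)
open import Function using (_∘_)

DLSteps-map : ∀ {K Ok Ok′ p π τ} (f : List ℕ → List ℕ) →
  (∀ {π ρ} → DLStep K Ok π ρ → DLStep K Ok′ (f π) (f ρ)) →
  DLSteps K Ok p π τ → DLSteps K Ok′ p (f π) (f τ)
DLSteps-map f g done        = done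
DLSteps-map f g (step s ss) = step (g s) (DLSteps-map f g ss)

++-assoc₃ : ∀ (xs ys zs ws : List ℕ) → (xs ++ ys ++ zs) ++ ws ≡ xs ++ ys ++ zs ++ ws
++-assoc₃ xs ys zs ws = trans (++-assoc xs (ys ++ zs) ws) (cong (xs ++_) (++-assoc ys zs ws))

DLStep-++ʳ : ∀ {K Ok π ρ} (L : List ℕ) → DLStep K Ok π ρ → DLStep K Ok (π ++ L) (ρ ++ L)
DLStep-++ʳ L (dlstep A W B mask split maskLen width okW result) =
  dlstep A W (B ++ L) mask
    (trans (cong (_++ L) split) (++-assoc₃ A W B L))
    maskLen width okW
    (trans (cong (_++ L) result)
      (trans (++-assoc₃ A S (T ++ B) L) (cong (λ z → A ++ S ++ z) (++-assoc T B L))))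
  where
  S T : List ℕ
  S = select true W mask
  T = select false W mask

select-[] : ∀ b xs → select b xs [] ≡ []
select-[] b []       = refl
select-[] b (x ∷ xs) = refl

module _ {P : Pred ℕ 0ℓ} (P? : Decidable P) where

  filterMask : List ℕ → List Bool → List Bool
  filterMask []       _        = []
  filterMask (x ∷ xs) []       = []
  filterMask (x ∷ xs) (c ∷ cs) with does (P? x)
  ... | true  = c ∷ filterMask xs cs
  ... | false = filterMask xs cs

  length-filterMask : ∀ W mask → length mask ≡ length W →
    length (filterMask W mask) ≡ length (filter P? W)
  length-filterMask []      mask     eq = refl
  length-filterMask (x ∷ W) (c ∷ cs) eq with does (P? x)
  ... | true  = cong suc (length-filterMask W cs (cong pred eq))
  ... | false = length-filterMask W cs (cong pred eq)

  select-filter : ∀ b W mask →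
    select b (filter P? W) (filterMask W mask) ≡ filter P? (select b W mask)
  select-filter b []      mask     = refl
  select-filter b (x ∷ W) []       with does (P? x)
  ... | true  = refl
  ... | false = select-[] b (filter P? W)
  select-filter true  (x ∷ W) (true  ∷ cs) with does (P? x)
  ... | true  = cong (x ∷_) (select-filter true W cs)
  ... | false = select-filter true W cs
  select-filter false (x ∷ W) (false ∷ cs) with does (P? x)
  ... | true  = cong (x ∷_) (select-filter false W cs)
  ... | false = select-filter false W cs
  select-filter true  (x ∷ W) (false ∷ cs) with does (P? x)
  ... | true  = select-filter true W cs
  ... | false = select-filter true W cs
  select-filter false (x ∷ W) (true  ∷ cs) with does (P? x)
  ... | true  = select-filter false W cs
  ... | false = select-filter false W cs

  DLStep-filter : ∀ {K Ok π ρ} → DLStep K Ok π ρ → DLStep K (All P) (filter P? π) (filter P? ρ)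
  DLStep-filter {π = π} {ρ} (dlstep A W B mask split maskLen width _ result) =
    dlstep (fl A) (fl W) (fl B) (filterMask W mask)
      (begin
        fl π                    ≡⟨ cong fl split ⟩
        fl (A ++ W ++ B)        ≡⟨ filter-++₃ A W B ⟩
        fl A ++ fl W ++ fl B    ∎)
      (length-filterMask W mask maskLen)
      (≤-trans (length-filter P? W) width)
      (all-filter P? W)
      (begin
        fl ρ                                         ≡⟨ cong fl result ⟩
        fl (A ++ S ++ T ++ B)                        ≡⟨ filter-++₃ A S (T ++ B) ⟩
        fl A ++ fl S ++ fl (T ++ B)                  ≡⟨ cong (λ z → fl A ++ fl S ++ z) (filter-++ P? T B) ⟩
        fl A ++ fl S ++ fl T ++ fl B                 ≡⟨ cong₂ (λ s t → fl A ++ s ++ t ++ fl B)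
                                                          (select-filter true W mask) (select-filter false W mask) ⟨
        fl A ++ select true (fl W) (filterMask W mask)
             ++ select false (fl W) (filterMask W mask) ++ fl B ∎)
    where
    open ≡-Reasoning
    fl : List ℕ → List ℕ
    fl = filter P?
    S T : List ℕ
    S = select true W mask
    T = select false W mask
    filter-++₃ : ∀ xs ys zs → fl (xs ++ ys ++ zs) ≡ fl xs ++ fl ys ++ fl zs
    filter-++₃ xs ys zs = trans (filter-++ P? xs (ys ++ zs)) (cong (fl xs ++_) (filter-++ P? ys zs))

  filter-++-prefix : ∀ {xs ys} → All P xs → All (∁ P) ys → filter P? (xs ++ ys) ≡ xs
  filter-++-prefix {xs} {ys} pxs ¬pys = begin
    filter P? (xs ++ ys)          ≡⟨ filter-++ P? xs ys ⟩
    filter P? xs ++ filter P? ys  ≡⟨ cong₂ _++_ (filter-all P? pxs) (filter-none P? ¬pys) ⟩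
    xs ++ []                      ≡⟨ ++-identityʳ xs ⟩
    xs                            ∎
    where open ≡-Reasoning

applyUpTo-++ : ∀ {A : Set} (f : ℕ → A) m n →
  applyUpTo f (m + n) ≡ applyUpTo f m ++ applyUpTo (f ∘ (m +_)) n
applyUpTo-++ f zero    n = refl
applyUpTo-++ f (suc m) n = cong (f 0 ∷_) (applyUpTo-++ (f ∘ suc) m n)

idPerm-+ : ∀ j m → idPerm (j + m) ≡ idPerm j ++ map (j +_) (idPerm m)
idPerm-+ j m = begin
  map suc (upTo (j + m))                    ≡⟨ cong (map suc) (applyUpTo-++ (λ i → i) j m) ⟩
  map suc (upTo j ++ applyUpTo (j +_) m)    ≡⟨ map-++ suc (upTo j) _ ⟩
  idPerm j ++ map suc (applyUpTo (j +_) m)  ≡⟨ cong (λ z → idPerm j ++ map suc z) (map-upTo (j +_) m) ⟨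
  idPerm j ++ map suc (map (j +_) (upTo m)) ≡⟨ cong (idPerm j ++_) (map-∘ (upTo m)) ⟨
  idPerm j ++ map (suc ∘ (j +_)) (upTo m)   ≡⟨ cong (idPerm j ++_) (map-cong (+-suc j) (upTo m)) ⟨
  idPerm j ++ map ((j +_) ∘ suc) (upTo m)   ≡⟨ cong (idPerm j ++_) (map-∘ (upTo m)) ⟩
  idPerm j ++ map (j +_) (idPerm m)         ∎
  where open ≡-Reasoning

All-≤-idPerm : ∀ j → All (_≤ j) (idPerm j)
All-≤-idPerm j = map⁺ (applyUpTo⁺₁ (λ i → i) j (λ i<j → i<j))

All->-shift-idPerm : ∀ j m → All (j <_) (map (j +_) (idPerm m))
All->-shift-idPerm j m = map⁺ (map⁺ (applyUpTo⁺₂ (λ i → i) m (λ _ → m<m+n j z<s)))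

lemma5 : (K p j n : ℕ) → 2 ≤ K → 1 ≤ p → j ≤ n →
    (σ' : List ℕ) → σ' ↭ idPerm j →
    DLSteps K AnyWindow p (idPerm n) (σ' ++ map (λ i → j + i) (idPerm (n ∸ j))) →
    DLSteps K (WindowIn j) p (idPerm n) (σ' ++ map (λ i → j + i) (idPerm (n ∸ j)))
lemma5 K p j n _ _ j≤n σ' σ'↭ steps =
  subst₂ (DLSteps K (WindowIn j) p)
    (trans (restore (idPerm j) (All-≤-idPerm j)) (sym idPerm-n))
    (restore σ' (All-resp-↭ (↭-sym σ'↭) (All-≤-idPerm j)))
    (DLSteps-map project (DLStep-++ʳ tail ∘ DLStep-filter (_≤? j))
      (subst (λ π → DLSteps K AnyWindow p π (σ' ++ tail)) idPerm-n steps))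
  where
  tail : List ℕ
  tail = map (j +_) (idPerm (n ∸ j))
  project : List ℕ → List ℕ
  project π = filter (_≤? j) π ++ tail
  idPerm-n : idPerm n ≡ idPerm j ++ tail
  idPerm-n = trans (cong idPerm (sym (m+[n∸m]≡n j≤n))) (idPerm-+ j (n ∸ j))
  restore : ∀ xs → All (_≤ j) xs → project (xs ++ tail) ≡ xs ++ tail
  restore xs xs≤j = cong (_++ tail)
    (filter-++-prefix (_≤? j) xs≤j (All.map <⇒≱ (All->-shift-idPerm j (n ∸ j))))
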